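{- Let $q$ be a prime power, $V$ an $n$-dimensional vector space over $\mathbb{F}_q$, $r\geq 2$ and $t,k$ positive integers. Let $\mathcal{F}\subseteq{V\brack k}$ be a non-trivial $r$-wise $t$-intersecting family and let $B_1,\ldots,B_d\in\mathcal{F}$ with $d\leq r$. Then $\dim(B_1\cap\cdots\cap B_d)\geq t+r-d$. Moreover, $\mathcal{F}$ is a non-trivial $(t+r-2)$-intersecting family.
   Context: ${V\brack k}$ is the set of $k$-subspaces of $V$. A family $\mathcal{F}\subseteq{V\brack k}$ is $r$-wise $t$-intersecting if $\dim(F_1\cap\cdots\cap F_r)\geq t$ for all (not necessarily distinct) $F_1,\ldots,F_r\in\mathcal{F}$; it is trivial if all its members contain a common $t$-subspace, and non-trivial otherwise. A family is $s$-intersecting if $\dim(A\cap B)\geq s$ for all $A,B$ in it, and such a family is non-trivial if its members do not all contain a common $s$-subspace. -}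

module Defs where

open import Level using (0ℓ)
open import Data.Nat using (ℕ; zero; suc; _≤_; _^_)
open import Data.Nat.Primality using (Prime)
open import Data.Fin using (Fin; zero; suc)
open import Data.Product using (Σ; ∃; _×_; _,_)
open import Relation.Nullary using (¬_)
open import Relation.Binary.PropositionalEquality using (_≡_)
open import Algebra.Bundles using (CommutativeRing)

record Field : Set₁ where
  field
    commRing : CommutativeRing 0ℓ 0ℓ
  open CommutativeRing commRing public
  field
    0≉1 : ¬ (0# ≈ 1#)
    inverse : ∀ x → ¬ (x ≈ 0#) → ∃ λ y → (x * y) ≈ 1#

record HasSize (𝔽 : Field) (q : ℕ) : Set where
  open Field 𝔽
  field
    enum : Fin q → Carrier
    enum-injective : ∀ i j → enum i ≈ enum j → i ≡ j
    enum-surjective : ∀ x → ∃ λ i → enum i ≈ x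

IsPrimePower : ℕ → Set
IsPrimePower q = Σ ℕ λ p → Σ ℕ λ e → Prime p × (1 ≤ e) × (q ≡ p ^ e)

module LinAlg (𝔽 : Field) (n : ℕ) where
  open Field 𝔽 using (Carrier; _≈_; _+_; _*_; 0#)

  Vec : Set
  Vec = Fin n → Carrier

  _≈ᵥ_ : Vec → Vec → Set
  u ≈ᵥ v = ∀ i → u i ≈ v i

  0ᵥ : Vec
  0ᵥ _ = 0#

  _+ᵥ_ : Vec → Vec → Vec
  (u +ᵥ v) i = u i + v i

  _·ᵥ_ : Carrier → Vec → Vec
  (c ·ᵥ v) i = c * v i

  lincomb : ∀ {m} → (Fin m → Carrier) → (Fin m → Vec) → Vec
  lincomb {zero} c u = 0ᵥ
  lincomb {suc m} c u = (c zero ·ᵥ u zero) +ᵥ lincomb (λ i → c (suc i)) (λ i → u (suc i))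

  LinearlyIndependent : ∀ {m} → (Fin m → Vec) → Set
  LinearlyIndependent {m} u =
    ∀ (c : Fin m → Carrier) → lincomb c u ≈ᵥ 0ᵥ → ∀ i → c i ≈ 0#

  record Subspace : Set₁ where
    field
      _∋_ : Vec → Set
      ∋-resp : ∀ {u v} → u ≈ᵥ v → _∋_ u → _∋_ v
      ∋-0 : _∋_ 0ᵥ
      ∋-+ : ∀ {u v} → _∋_ u → _∋_ v → _∋_ (u +ᵥ v)
      ∋-· : ∀ c {v} → _∋_ v → _∋_ (c ·ᵥ v)
  open Subspace public

  _⊆ˢ_ : Subspace → Subspace → Set
  A ⊆ˢ B = ∀ v → A ∋ v → B ∋ v

  DimAtLeast : Subspace → ℕ → Set
  DimAtLeast W m = Σ (Fin m → Vec) λ u → (∀ i → W ∋ u i) × LinearlyIndependent u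

  HasDim : Subspace → ℕ → Set
  HasDim W m = Σ (Fin m → Vec) λ u →
    (∀ i → W ∋ u i) × LinearlyIndependent u ×
    (∀ v → W ∋ v → ∃ λ c → v ≈ᵥ lincomb c u)

  -- intersection B_1 ∩ ... ∩ B_d (of d ≥ 1 subspaces; for d = 0 this is V)
  ⋂ : ∀ {d} → (Fin d → Subspace) → Subspace
  ⋂ B = record
    { _∋_ = λ v → ∀ i → B i ∋ v
    ; ∋-resp = λ e h i → ∋-resp (B i) e (h i)
    ; ∋-0 = λ i → ∋-0 (B i)
    ; ∋-+ = λ h h' i → ∋-+ (B i) (h i) (h' i)
    ; ∋-· = λ c h i → ∋-· (B i) c (h i)
    }

  _∩ˢ_ : Subspace → Subspace → Subspace
  A ∩ˢ B = record
    { _∋_ = λ v → (A ∋ v) × (B ∋ v)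
    ; ∋-resp = λ { e (a , b) → ∋-resp A e a , ∋-resp B e b }
    ; ∋-0 = ∋-0 A , ∋-0 B
    ; ∋-+ = λ { (a , b) (a' , b') → ∋-+ A a a' , ∋-+ B b b' }
    ; ∋-· = λ { c (a , b) → ∋-· A c a , ∋-· B c b }
    }

  Family : Set₂
  Family = Subspace → Set₁

  IsKFamily : ℕ → Family → Set₁
  IsKFamily k 𝓕 = ∀ F → 𝓕 F → HasDim F k

  IsRWiseTIntersecting : ℕ → ℕ → Family → Set₁
  IsRWiseTIntersecting r t 𝓕 =
    ∀ (F : Fin r → Subspace) → (∀ i → 𝓕 (F i)) → DimAtLeast (⋂ F) t

  IsTrivial : ℕ → Family → Set₁
  IsTrivial t 𝓕 = Σ Subspace λ T → HasDim T t × (∀ F → 𝓕 F → T ⊆ˢ F)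

  NonTrivial : ℕ → Family → Set₁
  NonTrivial t 𝓕 = ¬ IsTrivial t 𝓕

  IsIntersecting : ℕ → Family → Set₁
  IsIntersecting s 𝓕 = ∀ A B → 𝓕 A → 𝓕 B → DimAtLeast (A ∩ˢ B) s

{-# OPTIONS --safe #-}
-- Downward induction on d, starting at d = r, where the bound is r-wise t-intersection (pad B
-- with copies of B₁).  If W = B₁ ∩ ⋯ ∩ B_d has dimension ≥ m ≥ t but not ≥ m + 1, then m
-- independent vectors of W lie in every F ∈ 𝓕: a vector of W outside F, together with m
-- independent vectors of F ∩ W (the case d + 1), would give m + 1 independent vectors in W.
-- Any t of them span a t-space common to 𝓕, against non-triviality.  Over a finite field
-- membership and dimension are decidable by exhaustive search, which makes this argument by
-- contradiction constructive; only the finiteness of 𝔽 is used (not that q is a prime power,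
-- nor t, k ≥ 1).
module Submission where

open import Defs
open import Function using (_∘_)
open import Data.Nat using (ℕ; zero; suc; _∸_; _≤_; z≤n; s≤s)
import Data.Nat.Properties as ℕ
open import Data.Fin using (Fin; zero; suc; _↑ˡ_; _↑ʳ_; splitAt; _≟_)
open import Data.Fin.Properties using (any?; all?)
open import Data.Vec.Functional using ([]; _∷_; _++_; head; tail)
open import Data.Vec.Functional.Properties using (lookup-++ˡ)
open import Data.Vec.Functional.Relation.Binary.Pointwise using (Pointwise)
open import Data.Product using (∃; _×_; _,_; proj₁; proj₂)
open import Data.Sum using (inj₁; inj₂)
open import Data.Empty using (⊥-elim)
open import Relation.Nullary using (¬_; Dec; yes; no)
open import Relation.Nullary.Decidable using (_×-dec_; ¬?; map′; decidable-stable)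
open import Relation.Unary using (Decidable)
open import Relation.Binary.Definitions using (Reflexive; _Respects_)
import Relation.Binary.PropositionalEquality as ≡
open ≡ using (subst)
import Algebra.Properties.Group as GroupProperties
import Algebra.Properties.Ring as RingProperties
import Algebra.Properties.CommutativeSemigroup as CommutativeSemigroupProperties

Searchable : (X : Set) → (X → X → Set) → Set₁
Searchable X _~_ = ∀ (P : X → Set) → P Respects _~_ → Decidable P → Dec (∃ P)

searchable-Π : ∀ {X : Set} {_~_ : X → X → Set} → Reflexive _~_ → Searchable X _~_ →
  ∀ m → Searchable (Fin m → X) (Pointwise _~_)
searchable-Π ~-refl search zero P P-resp P? =
  map′ ([] ,_) (λ { (f , p) → P-resp (λ ()) p }) (P? [])
searchable-Π {_~_ = _~_} ~-refl search (suc m) P P-resp P? =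
  map′ (λ { (a , g , p) → a ∷ g , p })
       (λ { (f , p) → head f , tail f , P-resp (λ { zero → ~-refl ; (suc i) → ~-refl }) p })
       (search (λ a → ∃ λ g → P (a ∷ g)) head-resp λ a →
         searchable-Π ~-refl search m (λ g → P (a ∷ g))
           (λ g~h → P-resp λ { zero → ~-refl ; (suc i) → g~h i }) (λ g → P? (a ∷ g)))
  where
  head-resp : (λ a → ∃ λ g → P (a ∷ g)) Respects _~_
  head-resp a~b (g , p) = g , P-resp (λ { zero → a~b ; (suc i) → ~-refl }) p

module LinearAlgebra (𝔽 : Field) (n : ℕ) where
  open Field 𝔽 hiding (zero)
  open LinAlg 𝔽 n public
  open GroupProperties +-group using (inverseˡ-unique)
  open RingProperties ring using (-‿distribˡ-*; -‿distribʳ-*)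
  open CommutativeSemigroupProperties +-commutativeSemigroup using (interchange)
  open import Relation.Binary.Reasoning.Setoid setoid

  ≈ᵥ-refl : ∀ {u} → u ≈ᵥ u
  ≈ᵥ-refl i = refl
  ≈ᵥ-sym : ∀ {u v} → u ≈ᵥ v → v ≈ᵥ u
  ≈ᵥ-sym e i = sym (e i)
  ≈ᵥ-trans : ∀ {u v w} → u ≈ᵥ v → v ≈ᵥ w → u ≈ᵥ w
  ≈ᵥ-trans e f i = trans (e i) (f i)

  lincomb-cong : ∀ {m} {c c' : Fin m → Carrier} {u u' : Fin m → Vec} →
    Pointwise _≈_ c c' → Pointwise _≈ᵥ_ u u' → lincomb c u ≈ᵥ lincomb c' u'
  lincomb-cong {zero} c≈c' u≈u' j = refl
  lincomb-cong {suc m} c≈c' u≈u' j =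
    +-cong (*-cong (c≈c' zero) (u≈u' zero j)) (lincomb-cong (c≈c' ∘ suc) (u≈u' ∘ suc) j)

  lincomb-0 : ∀ {m} (u : Fin m → Vec) → lincomb (λ _ → 0#) u ≈ᵥ 0ᵥ
  lincomb-0 {zero} u j = refl
  lincomb-0 {suc m} u j = trans (+-cong (zeroˡ (u zero j)) (lincomb-0 (tail u) j)) (+-identityʳ 0#)

  unit : ∀ {m} → Fin m → Fin m → Carrier
  unit zero zero = 1#
  unit zero (suc _) = 0#
  unit (suc _) zero = 0#
  unit (suc i) (suc j) = unit i j

  lincomb-unit : ∀ {m} (i : Fin m) (u : Fin m → Vec) → lincomb (unit i) u ≈ᵥ u i
  lincomb-unit zero u j =
    trans (+-cong (*-identityˡ (u zero j)) (lincomb-0 (tail u) j)) (+-identityʳ (u zero j))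
  lincomb-unit (suc i) u j =
    trans (+-cong (zeroˡ (u zero j)) (lincomb-unit i (tail u) j)) (+-identityˡ (u (suc i) j))

  lincomb-+ : ∀ {m} (c c' : Fin m → Carrier) (u : Fin m → Vec) →
    lincomb (λ i → c i + c' i) u ≈ᵥ (lincomb c u +ᵥ lincomb c' u)
  lincomb-+ {zero} c c' u j = sym (+-identityʳ 0#)
  lincomb-+ {suc m} c c' u j =
    trans (+-cong (distribʳ (u zero j) (c zero) (c' zero)) (lincomb-+ (tail c) (tail c') (tail u) j))
          (interchange _ _ _ _)

  lincomb-· : ∀ {m} (s : Carrier) (c : Fin m → Carrier) (u : Fin m → Vec) →
    lincomb (λ i → s * c i) u ≈ᵥ (s ·ᵥ lincomb c u)
  lincomb-· {zero} s c u j = sym (zeroʳ s)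
  lincomb-· {suc m} s c u j =
    trans (+-cong (*-assoc s (c zero) (u zero j)) (lincomb-· s (tail c) (tail u) j))
          (sym (distribˡ s _ _))

  ∋-lincomb : ∀ {m} (W : Subspace) (c : Fin m → Carrier) {u : Fin m → Vec} →
    (∀ i → W ∋ u i) → W ∋ lincomb c u
  ∋-lincomb {zero} W c u∈W = ∋-0 W
  ∋-lincomb {suc m} W c u∈W = ∋-+ W (∋-· W (c zero) (u∈W zero)) (∋-lincomb W (tail c) (u∈W ∘ suc))

  span : ∀ {m} → (Fin m → Vec) → Subspace
  span {m} u = record
    { _∋_ = λ v → ∃ λ (c : Fin m → Carrier) → v ≈ᵥ lincomb c u
    ; ∋-resp = λ { v≈w (c , v≈cu) → c , ≈ᵥ-trans (≈ᵥ-sym v≈w) v≈cu }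
    ; ∋-0 = (λ _ → 0#) , ≈ᵥ-sym (lincomb-0 u)
    ; ∋-+ = λ { (c , v≈cu) (c' , w≈c'u) →
        (λ i → c i + c' i) , ≈ᵥ-trans (λ j → +-cong (v≈cu j) (w≈c'u j)) (≈ᵥ-sym (lincomb-+ c c' u)) }
    ; ∋-· = λ { s (c , v≈cu) →
        (λ i → s * c i) , ≈ᵥ-trans (λ j → *-congˡ (v≈cu j)) (≈ᵥ-sym (lincomb-· s c u)) }
    }

  span-hasDim : ∀ {m} (u : Fin m → Vec) → LinearlyIndependent u → HasDim (span u) m
  span-hasDim u u-indep = u , (λ i → unit i , ≈ᵥ-sym (lincomb-unit i u)) , u-indep , λ v v∈ → v∈

  span-⊆ : ∀ {m} {u : Fin m → Vec} (W : Subspace) → (∀ i → W ∋ u i) → span u ⊆ˢ W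
  span-⊆ W u∈W v (c , v≈cu) = ∋-resp W (≈ᵥ-sym v≈cu) (∋-lincomb W c u∈W)

  linearlyIndependent-resp : ∀ {m} → LinearlyIndependent {m} Respects Pointwise _≈ᵥ_
  linearlyIndependent-resp u≈u' u-indep c cu'≈0 =
    u-indep c (≈ᵥ-trans (lincomb-cong (λ _ → refl) u≈u') cu'≈0)

  linearlyIndependent-tail : ∀ {m} {u : Fin (suc m) → Vec} →
    LinearlyIndependent u → LinearlyIndependent (tail u)
  linearlyIndependent-tail {u = u} u-indep c cu≈0 i = u-indep (0# ∷ c) 0∷cu≈0 (suc i)
    where
    0∷cu≈0 : lincomb (0# ∷ c) u ≈ᵥ 0ᵥ
    0∷cu≈0 j = trans (+-cong (zeroˡ (u zero j)) (cu≈0 j)) (+-identityʳ 0#)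

  ∩ˢ-⊆ˡ : ∀ A B → (A ∩ˢ B) ⊆ˢ A
  ∩ˢ-⊆ˡ A B v = proj₁

  ∩ˢ-⊆ʳ : ∀ A B → (A ∩ˢ B) ⊆ˢ B
  ∩ˢ-⊆ʳ A B v = proj₂

  ⋂-∷-⊆ : ∀ {d} F (B : Fin d → Subspace) → ⋂ (F ∷ B) ⊆ˢ (F ∩ˢ ⋂ B)
  ⋂-∷-⊆ F B v v∈ = v∈ zero , v∈ ∘ suc

  dimAtLeast-mono : ∀ {m} A B → A ⊆ˢ B → DimAtLeast A m → DimAtLeast B m
  dimAtLeast-mono A B A⊆B (u , u∈A , u-indep) = u , (λ i → A⊆B (u i) (u∈A i)) , u-indep

  module _ (_≈?_ : ∀ x y → Dec (x ≈ y)) where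

    linearlyIndependent-∷ : ∀ {m} {F : Subspace} {v : Vec} {u : Fin m → Vec} → ¬ (F ∋ v) →
      (∀ i → F ∋ u i) → LinearlyIndependent u → LinearlyIndependent (v ∷ u)
    linearlyIndependent-∷ {F = F} {v} {u} v∉F u∈F u-indep c c[v∷u]≈0 with c zero ≈? 0#
    ... | yes c₀≈0 = λ { zero → c₀≈0 ; (suc i) → u-indep (tail c) cu≈0 i }
      where
      cu≈0 : lincomb (tail c) u ≈ᵥ 0ᵥ
      cu≈0 j = begin
        lincomb (tail c) u j                   ≈⟨ +-identityˡ _ ⟨
        0# + lincomb (tail c) u j              ≈⟨ +-congʳ (zeroˡ (v j)) ⟨
        0# * v j + lincomb (tail c) u j        ≈⟨ +-congʳ (*-congʳ c₀≈0) ⟨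
        c zero * v j + lincomb (tail c) u j    ≈⟨ c[v∷u]≈0 j ⟩
        0#                                     ∎
    ... | no c₀≉0 = ⊥-elim (v∉F (∋-resp F (≈ᵥ-sym v≈) (∋-· F (- c₀⁻¹) (∋-lincomb F (tail c) u∈F))))
      where
      c₀⁻¹ = proj₁ (inverse (c zero) c₀≉0)
      L = lincomb (tail c) u
      v≈ : v ≈ᵥ ((- c₀⁻¹) ·ᵥ L)
      v≈ j = begin
        v j                      ≈⟨ *-identityˡ (v j) ⟨
        1# * v j                 ≈⟨ *-congʳ (proj₂ (inverse (c zero) c₀≉0)) ⟨
        (c zero * c₀⁻¹) * v j    ≈⟨ *-congʳ (*-comm (c zero) c₀⁻¹) ⟩
        (c₀⁻¹ * c zero) * v j    ≈⟨ *-assoc c₀⁻¹ (c zero) (v j) ⟩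
        c₀⁻¹ * (c zero * v j)    ≈⟨ *-congˡ (inverseˡ-unique (c zero * v j) (L j) (c[v∷u]≈0 j)) ⟩
        c₀⁻¹ * (- L j)           ≈⟨ -‿distribʳ-* c₀⁻¹ (L j) ⟨
        - (c₀⁻¹ * L j)           ≈⟨ -‿distribˡ-* c₀⁻¹ (L j) ⟩
        (- c₀⁻¹) * L j           ∎

    dimAtLeast-suc : ∀ {v m} U W F → U ⊆ˢ W → U ⊆ˢ F → W ∋ v → ¬ (F ∋ v) →
      DimAtLeast U m → DimAtLeast W (suc m)
    dimAtLeast-suc {v} U W F U⊆W U⊆F v∈W v∉F (u , u∈U , u-indep) =
      v ∷ u ,
      (λ { zero → v∈W ; (suc i) → U⊆W (u i) (u∈U i) }) ,
      linearlyIndependent-∷ {F = F} v∉F (λ i → U⊆F (u i) (u∈U i)) u-indep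

module FiniteField (𝔽 : Field) {q : ℕ} (𝔽-size : HasSize 𝔽 q) (n : ℕ) where
  open Field 𝔽 hiding (zero)
  open HasSize 𝔽-size
  open LinearAlgebra 𝔽 n

  _≈?_ : ∀ x y → Dec (x ≈ y)
  x ≈? y with enum-surjective x | enum-surjective y
  ... | i , iₓ≈x | j , jᵧ≈y with i ≟ j
  ...   | yes ≡.refl = yes (trans (sym iₓ≈x) jᵧ≈y)
  ...   | no i≢j = no λ x≈y → i≢j (enum-injective i j (trans iₓ≈x (trans x≈y (sym jᵧ≈y))))

  _≈ᵥ?_ : ∀ u v → Dec (u ≈ᵥ v)
  u ≈ᵥ? v = all? (λ i → u i ≈? v i)

  searchable-Carrier : Searchable Carrier _≈_
  searchable-Carrier P P-resp P? =
    map′ (λ { (i , p) → enum i , p })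
         (λ { (x , p) → proj₁ (enum-surjective x) , P-resp (sym (proj₂ (enum-surjective x))) p })
         (any? (P? ∘ enum))

  searchable-coefficients : ∀ m → Searchable (Fin m → Carrier) (Pointwise _≈_)
  searchable-coefficients = searchable-Π refl searchable-Carrier

  searchable-vectors : ∀ m → Searchable (Fin m → Vec) (Pointwise _≈ᵥ_)
  searchable-vectors = searchable-Π ≈ᵥ-refl (searchable-coefficients n)

  hasDim⇒∋? : ∀ {k} F → HasDim F k → Decidable (F ∋_)
  hasDim⇒∋? {k} F (u , u∈F , _ , F⊆span) v =
    map′ (λ { (c , v≈cu) → ∋-resp F (≈ᵥ-sym v≈cu) (∋-lincomb F c u∈F) }) (F⊆span v)
      (searchable-coefficients k (λ c → v ≈ᵥ lincomb c u)
        (λ c≈c' v≈cu → ≈ᵥ-trans v≈cu (lincomb-cong c≈c' (λ _ → ≈ᵥ-refl)))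
        (λ c → v ≈ᵥ? lincomb c u))

  ⋂-∋? : ∀ {d} (B : Fin d → Subspace) → (∀ i → Decidable (B i ∋_)) → Decidable (⋂ B ∋_)
  ⋂-∋? B B? v = all? (λ i → B? i v)

  linearlyIndependent? : ∀ {m} (u : Fin m → Vec) → Dec (LinearlyIndependent u)
  linearlyIndependent? {m} u =
    map′ (λ no-dependency c cu≈0 →
           decidable-stable (all? (λ i → c i ≈? 0#)) λ c≉0 → no-dependency (c , cu≈0 , c≉0))
         (λ u-indep → λ { (c , cu≈0 , c≉0) → c≉0 (u-indep c cu≈0) })
         (¬? (searchable-coefficients m Dependency Dependency-resp Dependency?))
    where
    Dependency : (Fin m → Carrier) → Set
    Dependency c = lincomb c u ≈ᵥ 0ᵥ × ¬ (∀ i → c i ≈ 0#)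
    Dependency-resp : Dependency Respects Pointwise _≈_
    Dependency-resp c≈c' (cu≈0 , c≉0) =
      ≈ᵥ-trans (lincomb-cong (λ i → sym (c≈c' i)) (λ _ → ≈ᵥ-refl)) cu≈0 ,
      λ c'≈0 → c≉0 λ i → trans (c≈c' i) (c'≈0 i)
    Dependency? : Decidable Dependency
    Dependency? c = (lincomb c u ≈ᵥ? 0ᵥ) ×-dec ¬? (all? (λ i → c i ≈? 0#))

  dimAtLeast? : ∀ W → Decidable (W ∋_) → ∀ m → Dec (DimAtLeast W m)
  dimAtLeast? W W? m =
    searchable-vectors m (λ u → (∀ i → W ∋ u i) × LinearlyIndependent u)
      (λ u≈u' (u∈W , u-indep) → (λ i → ∋-resp W (u≈u' i) (u∈W i)) , linearlyIndependent-resp u≈u' u-indep)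
      (λ u → all? (λ i → W? (u i)) ×-dec linearlyIndependent? u)

-- Imported only here: the modules above open the field, whose _+_ would clash.
open import Data.Nat using (_+_)

module Families (𝔽 : Field) (n : ℕ) where
  open LinearAlgebra 𝔽 n

  linearlyIndependent-↑ʳ : ∀ e {m} {u : Fin (e + m) → Vec} →
    LinearlyIndependent u → LinearlyIndependent (u ∘ (e ↑ʳ_))
  linearlyIndependent-↑ʳ zero u-indep = u-indep
  linearlyIndependent-↑ʳ (suc e) {u = u} u-indep =
    linearlyIndependent-↑ʳ e {u = tail u} (linearlyIndependent-tail {u = u} u-indep)

  isTrivial-of-common : ∀ e {t} {𝓕 : Family} (u : Fin (e + t) → Vec) → LinearlyIndependent u →
    (∀ F → 𝓕 F → ∀ i → F ∋ u i) → IsTrivial t 𝓕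
  isTrivial-of-common e u u-indep u∈𝓕 =
    span (u ∘ (e ↑ʳ_)) ,
    span-hasDim _ (linearlyIndependent-↑ʳ e {u = u} u-indep) ,
    λ F 𝓕F → span-⊆ F (λ i → u∈𝓕 F 𝓕F (e ↑ʳ i))

  nonTrivial-+ : ∀ e {t} {𝓕 : Family} → NonTrivial t 𝓕 → NonTrivial (e + t) 𝓕
  nonTrivial-+ e 𝓕-nontrivial (T , (u , u∈T , u-indep , _) , T⊆𝓕) =
    𝓕-nontrivial (isTrivial-of-common e u u-indep λ F 𝓕F i → T⊆𝓕 F 𝓕F (u i) (u∈T i))

  isRWise-≤ : ∀ {d r t} {𝓕 : Family} → suc d ≤ r →
    IsRWiseTIntersecting r t 𝓕 → IsRWiseTIntersecting (suc d) t 𝓕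
  isRWise-≤ {d} {𝓕 = 𝓕} d<r 𝓕-rwise G 𝓕G with ℕ.m≤n⇒∃[o]m+o≡n d<r
  ... | e , ≡.refl = dimAtLeast-mono (⋂ padded) (⋂ G) ⋂-padded⊆ (𝓕-rwise padded 𝓕-padded)
    where
    padded : Fin (suc d + e) → Subspace
    padded = G ++ λ _ → G zero
    𝓕-padded : ∀ j → 𝓕 (padded j)
    𝓕-padded j with splitAt (suc d) j
    ... | inj₁ i = 𝓕G i
    ... | inj₂ _ = 𝓕G zero
    ⋂-padded⊆ : ⋂ padded ⊆ˢ ⋂ G
    ⋂-padded⊆ v v∈ i = subst (λ B → B ∋ v) (lookup-++ˡ G _ i) (v∈ (i ↑ˡ e))

module NonTrivialFamily (𝔽 : Field) {q : ℕ} (𝔽-size : HasSize 𝔽 q) (n : ℕ) {k r t : ℕ}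
  (𝓕 : LinAlg.Family 𝔽 n) (𝓕-k : LinAlg.IsKFamily 𝔽 n k 𝓕)
  (𝓕-rwise : LinAlg.IsRWiseTIntersecting 𝔽 n r t 𝓕) (𝓕-nontrivial : LinAlg.NonTrivial 𝔽 n t 𝓕) where
  open LinearAlgebra 𝔽 n
  open Families 𝔽 n
  open FiniteField 𝔽 𝔽-size n

  member-∋? : ∀ F → 𝓕 F → Decidable (F ∋_)
  member-∋? F 𝓕F = hasDim⇒∋? F (𝓕-k F 𝓕F)

  dimAtLeast-suc-of-meets : ∀ e W → Decidable (W ∋_) → DimAtLeast W (e + t) →
    (∀ F → 𝓕 F → DimAtLeast (F ∩ˢ W) (e + t)) → DimAtLeast W (suc e + t)
  dimAtLeast-suc-of-meets e W W? (w , w∈W , w-indep) meets with dimAtLeast? W W? (suc e + t)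
  ... | yes dim = dim
  ... | no ¬dim = ⊥-elim (𝓕-nontrivial (isTrivial-of-common e {𝓕 = 𝓕} w w-indep w∈𝓕))
    where
    w∈𝓕 : ∀ F → 𝓕 F → ∀ i → F ∋ w i
    w∈𝓕 F 𝓕F i = decidable-stable (member-∋? F 𝓕F (w i)) λ wᵢ∉F →
      ¬dim (dimAtLeast-suc _≈?_ (F ∩ˢ W) W F (∩ˢ-⊆ʳ F W) (∩ˢ-⊆ˡ F W) (w∈W i) wᵢ∉F (meets F 𝓕F))

  ⋂-dimAtLeast-+ : ∀ e {d} (B : Fin (suc d) → Subspace) → (∀ i → 𝓕 (B i)) → suc d + e ≤ r →
    DimAtLeast (⋂ B) (e + t)
  ⋂-dimAtLeast-+ zero B 𝓕B d≤r = isRWise-≤ {𝓕 = 𝓕} (subst (_≤ r) (ℕ.+-identityʳ _) d≤r) 𝓕-rwise B 𝓕B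
  ⋂-dimAtLeast-+ (suc e) {d} B 𝓕B d+e<r =
    dimAtLeast-suc-of-meets e (⋂ B) (⋂-∋? B λ i → member-∋? (B i) (𝓕B i))
      (⋂-dimAtLeast-+ e B 𝓕B (ℕ.≤-trans (ℕ.+-monoʳ-≤ (suc d) (ℕ.n≤1+n e)) d+e<r))
      λ F 𝓕F → dimAtLeast-mono (⋂ (F ∷ B)) (F ∩ˢ ⋂ B) (⋂-∷-⊆ F B)
        (⋂-dimAtLeast-+ e (F ∷ B) (λ { zero → 𝓕F ; (suc i) → 𝓕B i })
          (subst (_≤ r) (ℕ.+-suc (suc d) e) d+e<r))

  ⋂-dimAtLeast : (d : ℕ) → 1 ≤ d → d ≤ r → (B : Fin d → Subspace) → (∀ i → 𝓕 (B i)) →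
    DimAtLeast (⋂ B) (t + (r ∸ d))
  ⋂-dimAtLeast (suc d) _ d≤r B 𝓕B =
    subst (DimAtLeast (⋂ B)) (ℕ.+-comm (r ∸ suc d) t)
      (⋂-dimAtLeast-+ (r ∸ suc d) B 𝓕B (ℕ.≤-reflexive (ℕ.m+[n∸m]≡n d≤r)))

  isIntersecting : 2 ≤ r → IsIntersecting (t + r ∸ 2) 𝓕
  isIntersecting 2≤r A B 𝓕A 𝓕B =
    subst (DimAtLeast (A ∩ˢ B)) (≡.sym (ℕ.+-∸-assoc t 2≤r))
      (dimAtLeast-mono (⋂ AB) (A ∩ˢ B) ⋂AB⊆A∩B
        (⋂-dimAtLeast 2 (s≤s z≤n) 2≤r AB λ { zero → 𝓕A ; (suc _) → 𝓕B }))
    where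
    AB : Fin 2 → Subspace
    AB = A ∷ λ _ → B
    ⋂AB⊆A∩B : ⋂ AB ⊆ˢ (A ∩ˢ B)
    ⋂AB⊆A∩B v v∈ = v∈ zero , v∈ (suc zero)

corollary4p3 : (q : ℕ) → IsPrimePower q → (𝔽 : Field) → HasSize 𝔽 q →
    (n r t k : ℕ) → 2 ≤ r → 1 ≤ t → 1 ≤ k →
    let open LinAlg 𝔽 n in
    (𝓕 : Family) → IsKFamily k 𝓕 → IsRWiseTIntersecting r t 𝓕 → NonTrivial t 𝓕 →
    ((d : ℕ) → 1 ≤ d → d ≤ r → (B : Fin d → Subspace) → (∀ i → 𝓕 (B i)) →
      DimAtLeast (⋂ B) (t + (r ∸ d)))
    × (IsIntersecting (t + r ∸ 2) 𝓕 × NonTrivial (t + r ∸ 2) 𝓕)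
corollary4p3 _ _ 𝔽 𝔽-size n r t _ 2≤r _ _ 𝓕 𝓕-k 𝓕-rwise 𝓕-nontrivial =
  ⋂-dimAtLeast ,
  isIntersecting 2≤r ,
  subst (λ s → NonTrivial s 𝓕) (≡.trans (ℕ.+-comm (r ∸ 2) t) (≡.sym (ℕ.+-∸-assoc t 2≤r)))
    (nonTrivial-+ (r ∸ 2) 𝓕-nontrivial)
  where
  open LinAlg 𝔽 n using (NonTrivial)
  open Families 𝔽 n using (nonTrivial-+)
  open NonTrivialFamily 𝔽 𝔽-size n 𝓕 𝓕-k 𝓕-rwise 𝓕-nontrivial
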